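{- Let $g:\Delta\to\{0,1\}$ be a partial Boolean function with domain $\Delta\subseteq\{0,1\}^N$. If $g$ can be computed by an $R$-round deterministic $\mathsf{AMPC}$ algorithm with I/O capacity $S$, then there exists a real polynomial $p(x_1,\dots,x_N)$ of degree at most $S^{2R}$ such that $p(x)=g(x)$ for every $x\in\Delta$ and $p(x)\in\{0,1\}$ for every $x\in\{0,1\}^N\setminus\Delta$. In particular, if $g$ is a total Boolean function, then $\deg(g)\le S^{2R}$.
   Context: For a total $g:\{0,1\}^N\to\{0,1\}$, $\deg(g)$ is the degree of the unique multilinear real polynomial agreeing with $g$ on $\{0,1\}^N$. The deterministic $\mathsf{AMPC}$ model with I/O capacity $S$: computation proceeds in rounds using shared key–value stores $\mathcal{D}_0,\mathcal{D}_1,\dots$. $\mathcal{D}_0$ holds the input $x\in\{0,1\}^N$ as the $N$ pairs $(i,x_i)$. In round $r\ge1$, each machine (arbitrarily many, computationally unbounded) adaptively issues a sequence of key queries to $\mathcal{D}_{r-1}$; the response to a query is the multiset of all values stored under that key (empty if none), and later queries may depend on earlier queries and responses. For each machine in each round, the total number of values received plus the number of queries with empty response is at most $S$, and the machine writes at most $S$ key–value pairs to $\mathcal{D}_r$; values under the same key are stored as a multiset (duplicates allowed, each value written by one machine). In every round, on every input in $\{0,1\}^N$ (including inputs outside $\Delta$), at most $S$ values are written under any single key. On inputs outside $\Delta$ the algorithm runs in the same way, and a machine whose query budget would be exceeded stops querying and writes nothing. An algorithm computes $g:\Delta\to\{0,1\}$ in $R$ rounds if for every $x\in\Delta$, $\mathcal{D}_R$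 contains exactly the single pair $(\textsc{answer}, g(x))$; on inputs outside $\Delta$, $\mathcal{D}_R$ holds some multiset (possibly empty) of at most $S$ bits under $\textsc{answer}$. -}

module Defs where

open import Data.Nat using (ℕ; zero; suc; _∸_; _≤_; _≤?_; _≟_)
open import Data.Nat.Properties using (≤-decTotalOrder)
open import Data.Fin using (Fin; toℕ)
open import Data.Bool using (Bool; true; false)
open import Data.List using (List; []; _∷_; map; filter; length; concat; foldr; allFin)
open import Data.List.Relation.Unary.All using (All)
open import Data.List.Relation.Unary.Unique.Propositional using (Unique)
open import Data.Maybe using (Maybe; just; nothing; fromMaybe; Is-just)
open import Data.Product using (_×_; _,_; proj₁; proj₂; Σ; ∃)
open import Data.Sum using (_⊎_; inj₁; inj₂)
open import Data.Unit using (⊤)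
open import Data.Empty using (⊥)
open import Data.Vec using (Vec; []; _∷_)
open import Data.Rational using (ℚ; 0ℚ; 1ℚ; _+_; _*_)
open import Relation.Nullary using (yes; no)
open import Relation.Binary.PropositionalEquality using (_≡_)
open import Data.List.Sort.InsertionSort.Base ≤-decTotalOrder using (sort)

Input : ℕ → Set
Input N = Fin N → Bool

bitℕ : Bool → ℕ
bitℕ true  = 1
bitℕ false = 0

bitℚ : Bool → ℚ
bitℚ true  = 1ℚ
bitℚ false = 0ℚ

-- A polynomial in variables x_0..x_{N-1}: a finite list of terms
-- (coefficient, monomial), a monomial being a list of variable indices
-- (repetitions allowed, i.e. x_i^2 etc. are allowed).
Monomial : ℕ → Set
Monomial N = List (Fin N)

Poly : ℕ → Set
Poly N = List (ℚ × Monomial N)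

evalMon : ∀ {N} → Input N → Monomial N → ℚ
evalMon x m = foldr (λ i acc → bitℚ (x i) * acc) 1ℚ m

eval : ∀ {N} → Poly N → Input N → ℚ
eval p x = foldr (λ t acc → proj₁ t * evalMon x (proj₂ t) + acc) 0ℚ p

DegreeAtMost : ∀ {N} → ℕ → Poly N → Set
DegreeAtMost D p = All (λ t → length (proj₂ t) ≤ D) p

Multilinear : ∀ {N} → Poly N → Set
Multilinear p = All (λ t → Unique (proj₂ t)) p

-- deg(g) ≤ D for a total Boolean function g: the (unique) multilinear
-- polynomial agreeing with g on {0,1}^N has degree ≤ D.
DegAtMost : ∀ {N} → (Input N → Bool) → ℕ → Set
DegAtMost {N} g D =
  Σ (Poly N) λ p → Multilinear p × DegreeAtMost D p × (∀ x → eval p x ≡ bitℚ (g x))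

-- The deterministic AMPC model
-- Keys and values are natural numbers.  Input pair (i , x_i) is stored
-- under key  suc (toℕ i)  with value 0/1; the ANSWER key is 0.

Key Value : Set
Key = ℕ
Value = ℕ

Store : Set
Store = List (Key × Value)

inputKey : ∀ {N} → Fin N → Key
inputKey i = suc (toℕ i)

answerKey : Key
answerKey = 0

initStore : ∀ {N} → Input N → Store
initStore {N} x = map (λ i → inputKey i , bitℕ (x i)) (allFin N)

valuesAt : Key → Store → List Value
valuesAt k D = map proj₂ (filter (λ kv → proj₁ kv ≟ k) D)

-- the response to a query: the multiset of values under k, given in a
-- canonical (sorted) form so that it carries no information beyond the multiset
response : Key → Store → List Value
response k D = sort (valuesAt k D)

cost : List Value → ℕ
cost []       = 1
cost (v ∷ vs) = length (v ∷ vs)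

-- history of (query , response) pairs, most recent first
History : Set
History = List (Key × List Value)

-- an adaptive machine: given its history, either issues the next query
-- (inj₁ k) or stops and writes the list of key–value pairs (inj₂ w)
Strategy : Set
Strategy = History → Key ⊎ Store

-- run with fuel and remaining budget; nothing = budget would be exceeded
-- (machine stops querying and writes nothing)
run : ℕ → ℕ → Strategy → Store → History → Maybe Store
run zero    b σ D h = nothing
run (suc f) b σ D h with σ h
... | inj₂ w = just w
... | inj₁ k with cost (response k D) ≤? b
...   | yes _ = run f (b ∸ cost (response k D)) σ D ((k , response k D) ∷ h)
...   | no  _ = nothing

-- a machine with I/O capacity S (each query costs ≥ 1, so S+1 steps suffice)
runMachine : ℕ → Strategy → Store → Maybe Store
runMachine S σ D = run (suc S) S σ D []

record Round : Set where
  field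
    M       : ℕ
    machine : Fin M → Strategy

open Round public

roundOut : ℕ → Round → Store → Store
roundOut S ρ D = concat (map (λ i → fromMaybe [] (runMachine S (machine ρ i) D)) (allFin (M ρ)))

Algorithm : ℕ → Set
Algorithm R = Vec Round R

finalStore : ∀ {R} → ℕ → Algorithm R → Store → Store
finalStore S []       D = D
finalStore S (ρ ∷ ρs) D = finalStore S ρs (roundOut S ρ D)

AllRounds : ∀ {R} → ℕ → (Round → Store → Set) → Algorithm R → Store → Set
AllRounds S P []       D = ⊤
AllRounds S P (ρ ∷ ρs) D = P ρ D × AllRounds S P ρs (roundOut S ρ D)

BudgetOK : ℕ → Round → Store → Set
BudgetOK S ρ D = ∀ i → Is-just (runMachine S (machine ρ i) D)

WriteOK : ℕ → Round → Store → Set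
WriteOK S ρ D = ∀ i w → runMachine S (machine ρ i) D ≡ just w → length w ≤ S

KeyOK : ℕ → Round → Store → Set
KeyOK S ρ D = ∀ k → length (valuesAt k (roundOut S ρ D)) ≤ S

record Computes {N : ℕ} (S R : ℕ) (Δ : Input N → Set) (g : ∀ x → Δ x → Bool)
                (A : Algorithm R) : Set where
  field
    budget   : ∀ x → Δ x → AllRounds S (BudgetOK S) A (initStore x)
    writes   : ∀ (x : Input N) → AllRounds S (WriteOK S) A (initStore x)
    perKey   : ∀ (x : Input N) → AllRounds S (KeyOK S) A (initStore x)
    correct  : ∀ x (d : Δ x) →
               valuesAt answerKey (finalStore S A (initStore x)) ≡ bitℕ (g x d) ∷ []
    outside  : ∀ x → (Δ x → ⊥) →
               All (λ v → v ≤ 1) (valuesAt answerKey (finalStore S A (initStore {N} x)))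
               × length (valuesAt answerKey (finalStore S A (initStore {N} x))) ≤ S

-- Every stage of the computation is tracked through the indicators [response to key k = V], viewed
-- as polynomials in the input bits. In the initial store each key carries at most one input bit, so
-- they have degree 1. If they have degree d before a round, a machine branches on its responses, each
-- costing at least one unit of its budget S, so its output indicators have degree S·d. The values
-- written under a key are the concatenation of the machines' contributions; at most S values land
-- under a key, so at most S contributions are nonempty and the indicator of the concatenation has
-- degree S·(S·d). After R rounds, the indicator that the answer is {1} is a 0/1-valued polynomial of
-- degree S^(2R) that equals g on Δ; for total g, reducing x_i² to x_i makes it multilinear.

module Submission where

module PolynomialSimulation where

  open import Defs
  open import Data.Bool using (Bool; true; false)
  open import Data.Empty using (⊥-elim)
  open import Data.Fin using (Fin; zero; suc)
  import Data.Fin.Properties as Fin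
  open import Data.List
    using (List; []; _∷_; [_]; _++_; map; length; concat; filter; deduplicate; allFin; cartesianProductWith)
  import Data.List.Properties as List
  open import Data.List.Membership.Propositional using (_∈_)
  import Data.List.Membership.Propositional.Properties as ∈
  open import Data.List.Relation.Unary.All as All using (All; []; _∷_)
  import Data.List.Relation.Unary.All.Properties as All
  open import Data.List.Relation.Unary.AllPairs using (_∷_)
  open import Data.List.Relation.Unary.Any using (here; there)
  open import Data.List.Relation.Unary.Unique.Propositional using (Unique)
  import Data.List.Relation.Unary.Unique.Propositional.Properties as Unique
  open import Data.List.Relation.Unary.Unique.DecPropositional.Properties using (deduplicate-!)
  open import Data.Maybe using (Maybe; just; nothing; maybe′; fromMaybe)
  import Data.Maybe.Properties as Maybe
  open import Data.Nat as ℕ using (ℕ; zero; suc; _≤_; _∸_; _^_; z≤n; s≤s)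
  import Data.Nat.Properties as ℕ
  open import Data.List.Sort.InsertionSort.Base ℕ.≤-decTotalOrder using (sort)
  import Data.Nat.Solver
  open import Data.Product using (_×_; _,_; proj₁; proj₂; Σ)
  import Data.Product.Properties as Product
  open import Data.Rational using (ℚ; 0ℚ; 1ℚ; _+_; _*_; -_; _-_)
  import Data.Rational.Properties as ℚ
  open import Data.Rational.Solver using (module +-*-Solver)
  open import Data.Sum as Sum using (_⊎_; inj₁; inj₂)
  open import Data.Unit using (⊤)
  import Data.Vec as Vec
  import Data.Vec.Functional as Vector
  open import Function using (_∘_; _⇔_; mk⇔)
  open import Relation.Binary.Definitions using (DecidableEquality)
  open import Relation.Binary.PropositionalEquality hiding ([_])
  open import Relation.Nullary using (Dec; yes; no; does; ¬_; ¬?)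
  open import Relation.Nullary.Decidable using (does-⇔)
  open +-*-Solver
  module ℕS = Data.Nat.Solver.+-*-Solver

  𝟙 : ∀ {P : Set} → Dec P → ℚ
  𝟙 P? = bitℚ (does P?)

  𝟙-boolean : ∀ {P : Set} (P? : Dec P) → 𝟙 P? ≡ 0ℚ ⊎ 𝟙 P? ≡ 1ℚ
  𝟙-boolean (no  _) = inj₁ refl
  𝟙-boolean (yes _) = inj₂ refl

  𝟙-⇔ : ∀ {P Q : Set} → P ⇔ Q → (P? : Dec P) (Q? : Dec Q) → 𝟙 P? ≡ 𝟙 Q?
  𝟙-⇔ P⇔Q P? Q? = cong bitℚ (does-⇔ P⇔Q P? Q?)

  sumOver : ∀ {A : Set} → List A → (A → ℚ) → ℚ
  sumOver []       f = 0ℚ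
  sumOver (a ∷ as) f = f a + sumOver as f

  module _ {A : Set} (_≟_ : DecidableEquality A) where

    sumOver-absent : ∀ {a as} (T : A → ℚ) → All (λ b → ¬ b ≡ a) as →
                     sumOver as (λ b → 𝟙 (a ≟ b) * T b) ≡ 0ℚ
    sumOver-absent     T []                 = refl
    sumOver-absent {a} T (_∷_ {b} b≢a b≢a*) with a ≟ b
    ... | yes a≡b = ⊥-elim (b≢a (sym a≡b))
    ... | no  _   = trans (cong (0ℚ * T b +_) (sumOver-absent T b≢a*))
                          (solve 1 (λ t → con 0ℚ :* t :+ con 0ℚ := con 0ℚ) refl (T b))

    sumOver-select : ∀ {a as} (T : A → ℚ) → Unique as → a ∈ as →
                     sumOver as (λ b → 𝟙 (a ≟ b) * T b) ≡ T a
    sumOver-select {a} T (a≢* ∷ _) (here refl) with a ≟ a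
    ... | no  a≢a = ⊥-elim (a≢a refl)
    ... | yes _   = trans (cong (1ℚ * T a +_) (sumOver-absent T (All.map (_∘ sym) a≢*)))
                          (solve 1 (λ t → con 1ℚ :* t :+ con 0ℚ := t) refl (T a))
    sumOver-select {a} {b ∷ _} T (b≢* ∷ u) (there a∈) with a ≟ b
    ... | yes refl = ⊥-elim (All.lookup b≢* a∈ refl)
    ... | no  _    = trans (cong (0ℚ * T b +_) (sumOver-select T u a∈))
                           (solve 2 (λ s t → con 0ℚ :* s :+ t := t) refl (T b) (T a))

  module _ {N : ℕ} where

    evalMon-++ : ∀ (m m′ : Monomial N) x → evalMon x (m ++ m′) ≡ evalMon x m * evalMon x m′
    evalMon-++ []      m′ x = sym (ℚ.*-identityˡ _)
    evalMon-++ (i ∷ m) m′ x = begin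
      bitℚ (x i) * evalMon x (m ++ m′)              ≡⟨ cong (bitℚ (x i) *_) (evalMon-++ m m′ x) ⟩
      bitℚ (x i) * (evalMon x m * evalMon x m′)     ≡⟨ ℚ.*-assoc (bitℚ (x i)) _ _ ⟨
      bitℚ (x i) * evalMon x m * evalMon x m′       ∎
      where open ≡-Reasoning

    eval-++ : ∀ (p q : Poly N) x → eval (p ++ q) x ≡ eval p x + eval q x
    eval-++ []            q x = sym (ℚ.+-identityˡ _)
    eval-++ ((c , m) ∷ p) q x =
      trans (cong (c * evalMon x m +_) (eval-++ p q x)) (sym (ℚ.+-assoc (c * evalMon x m) _ _))

    infixl 7 _·_ _*ₚ_

    _·_ : ℚ × Monomial N → Poly N → Poly N
    (c , m) · q = map (λ (c′ , m′) → c * c′ , m ++ m′) q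

    _*ₚ_ : Poly N → Poly N → Poly N
    []      *ₚ q = []
    (t ∷ p) *ₚ q = t · q ++ p *ₚ q

    eval-· : ∀ c m (q : Poly N) x → eval ((c , m) · q) x ≡ c * evalMon x m * eval q x
    eval-· c m []              x = sym (ℚ.*-zeroʳ (c * evalMon x m))
    eval-· c m ((c′ , m′) ∷ q) x
      rewrite eval-· c m q x | evalMon-++ m m′ x =
        solve 5 (λ a b a′ b′ r → a :* a′ :* (b :* b′) :+ a :* b :* r := a :* b :* (a′ :* b′ :+ r))
              refl c (evalMon x m) c′ (evalMon x m′) (eval q x)

    eval-*ₚ : ∀ (p q : Poly N) x → eval (p *ₚ q) x ≡ eval p x * eval q x
    eval-*ₚ []            q x = sym (ℚ.*-zeroˡ (eval q x))
    eval-*ₚ ((c , m) ∷ p) q x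
      rewrite eval-++ ((c , m) · q) (p *ₚ q) x | eval-· c m q x | eval-*ₚ p q x =
        sym (ℚ.*-distribʳ-+ (eval q x) (c * evalMon x m) (eval p x))

    degree-· : ∀ {a b} c (m : Monomial N) {q} → length m ≤ a → DegreeAtMost b q →
               DegreeAtMost (a ℕ.+ b) ((c , m) · q)
    degree-· c m m≤a []                 = []
    degree-· c m m≤a (m′≤b ∷ q≤b) =
      subst (_≤ _) (sym (List.length-++ m)) (ℕ.+-mono-≤ m≤a m′≤b) ∷ degree-· c m m≤a q≤b

    degree-*ₚ : ∀ {a b} {p q : Poly N} → DegreeAtMost a p → DegreeAtMost b q →
                DegreeAtMost (a ℕ.+ b) (p *ₚ q)
    degree-*ₚ []               q≤b = []
    degree-*ₚ {p = (c , m) ∷ _} (m≤a ∷ p≤a) q≤b =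
      All.++⁺ (degree-· c m m≤a q≤b) (degree-*ₚ p≤a q≤b)

    Deg≤On : (Input N → Set) → ℕ → (Input N → ℚ) → Set
    Deg≤On C d F = Σ (Poly N) λ p → DegreeAtMost d p × (∀ x → C x → eval p x ≡ F x)

    Deg≤ : ℕ → (Input N → ℚ) → Set
    Deg≤ = Deg≤On (λ _ → ⊤)

    module _ {C : Input N → Set} where

      Deg≤On-cong : ∀ {d F G} → (∀ x → C x → F x ≡ G x) → Deg≤On C d F → Deg≤On C d G
      Deg≤On-cong F≡G (p , p≤d , p≡F) = p , p≤d , λ x c → trans (p≡F x c) (F≡G x c)

      Deg≤On-mono : ∀ {d e F} → d ≤ e → Deg≤On C d F → Deg≤On C e F
      Deg≤On-mono d≤e (p , p≤d , p≡F) = p , All.map (λ m≤d → ℕ.≤-trans m≤d d≤e) p≤d , p≡F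

      Deg≤On-const : ∀ {d} c → Deg≤On C d (λ _ → c)
      Deg≤On-const c = (c , []) ∷ [] , z≤n ∷ [] , λ _ _ →
        trans (ℚ.+-identityʳ (c * 1ℚ)) (ℚ.*-identityʳ c)

      Deg≤On-+ : ∀ {d F G} → Deg≤On C d F → Deg≤On C d G → Deg≤On C d (λ x → F x + G x)
      Deg≤On-+ (p , p≤d , p≡F) (q , q≤d , q≡G) =
        p ++ q , All.++⁺ p≤d q≤d , λ x c → trans (eval-++ p q x) (cong₂ _+_ (p≡F x c) (q≡G x c))

      Deg≤On-* : ∀ {d e F G} → Deg≤On C d F → Deg≤On C e G →
                 Deg≤On C (d ℕ.+ e) (λ x → F x * G x)
      Deg≤On-* (p , p≤d , p≡F) (q , q≤e , q≡G) =
        p *ₚ q , degree-*ₚ p≤d q≤e ,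
        λ x c → trans (eval-*ₚ p q x) (cong₂ _*_ (p≡F x c) (q≡G x c))

      Deg≤On-*ʳ : ∀ {d F} c → Deg≤On C d F → Deg≤On C d (λ x → F x * c)
      Deg≤On-*ʳ {d} c F≤d =
        Deg≤On-mono (ℕ.≤-reflexive (ℕ.+-identityʳ d)) (Deg≤On-* F≤d (Deg≤On-const {0} c))

      Deg≤On-- : ∀ {d F G} → Deg≤On C d F → Deg≤On C d G → Deg≤On C d (λ x → F x - G x)
      Deg≤On-- {F = F} {G} F≤d G≤d =
        Deg≤On-cong (λ x _ → solve 2 (λ f g → f :+ g :* con (- 1ℚ) := f :- g) refl (F x) (G x))
                    (Deg≤On-+ F≤d (Deg≤On-*ʳ (- 1ℚ) G≤d))

      Deg≤On-sumOver : ∀ {A : Set} {d} (as : List A) {F : A → Input N → ℚ} →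
                       (∀ a → Deg≤On C d (F a)) → Deg≤On C d (λ x → sumOver as (λ a → F a x))
      Deg≤On-sumOver []       F≤d = Deg≤On-const 0ℚ
      Deg≤On-sumOver (a ∷ as) F≤d = Deg≤On-+ (F≤d a) (Deg≤On-sumOver as F≤d)

      Deg≤On-weaken : ∀ {C′ : Input N → Set} {d F} → (∀ x → C′ x → C x) →
                      Deg≤On C d F → Deg≤On C′ d F
      Deg≤On-weaken C′⇒C (p , p≤d , p≡F) = p , p≤d , λ x c′ → p≡F x (C′⇒C x c′)

    Deg≤-var : ∀ i → Deg≤ 1 (λ x → bitℚ (x i))
    Deg≤-var i = (1ℚ , i ∷ []) ∷ [] , s≤s z≤n ∷ [] , λ x _ →
      solve 1 (λ b → con 1ℚ :* (b :* con 1ℚ) :+ con 0ℚ := b) refl (bitℚ (x i))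

    Deg≤-bit : ∀ i (T : Bool → ℚ) → Deg≤ 1 (λ x → T (x i))
    Deg≤-bit i T = Deg≤On-cong T-affine
      (Deg≤On-+ (Deg≤On-const (T false)) (Deg≤On-*ʳ (T true - T false) (Deg≤-var i)))
      where
      T-affine : ∀ (x : Input N) → ⊤ → T false + bitℚ (x i) * (T true - T false) ≡ T (x i)
      T-affine x _ with x i
      ... | true  = solve 2 (λ t f → f :+ con 1ℚ :* (t :- f) := t) refl (T true) (T false)
      ... | false = solve 2 (λ t f → f :+ con 0ℚ :* (t :- f) := f) refl (T true) (T false)

    FiniteRange : ∀ {A : Set} → (Input N → A) → Set
    FiniteRange {A} q = Σ (List A) λ as → ∀ x → q x ∈ as

    FiniteRange-∘ : ∀ {A B : Set} {q : Input N → A} (h : A → B) → FiniteRange q → FiniteRange (h ∘ q)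
    FiniteRange-∘ h (as , q∈as) = map h as , λ x → ∈.∈-map⁺ h (q∈as x)

    FiniteRange-bit : ∀ {A : Set} i (h : Bool → A) → FiniteRange (λ x → h (x i))
    FiniteRange-bit i h = h true ∷ h false ∷ [] , λ x → h∈ (x i)
      where
      h∈ : ∀ b → h b ∈ h true ∷ h false ∷ []
      h∈ true  = here refl
      h∈ false = there (here refl)

    IndicatorsDeg≤ : ∀ {A : Set} → DecidableEquality A → ℕ → (Input N → A) → Set
    IndicatorsDeg≤ _≟_ d q = ∀ a → Deg≤ d (λ x → 𝟙 (q x ≟ a))

    module _ {A : Set} (_≟_ : DecidableEquality A) where

      Deg≤On-caseOn : ∀ {C d} {q : Input N → A} → FiniteRange q → (T : A → Input N → ℚ) →
                      (∀ a → Deg≤On C d (λ x → 𝟙 (q x ≟ a) * T a x)) →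
                      Deg≤On C d (λ x → T (q x) x)
      Deg≤On-caseOn (as , q∈as) T terms =
        Deg≤On-cong
          (λ x _ → sumOver-select _≟_ (λ a → T a x) (deduplicate-! _≟_ as)
                                  (∈.∈-deduplicate⁺ _≟_ (q∈as x)))
          (Deg≤On-sumOver (deduplicate _≟_ as) terms)

      Deg≤-∘ : ∀ {d} {q : Input N → A} → FiniteRange q → IndicatorsDeg≤ _≟_ d q → (T : A → ℚ) →
               Deg≤ d (λ x → T (q x))
      Deg≤-∘ range q≤d T = Deg≤On-caseOn range (λ a _ → T a) (λ a → Deg≤On-*ʳ (T a) (q≤d a))

      IndicatorsDeg≤-∘ : ∀ {B : Set} (_≟ᴮ_ : DecidableEquality B) {d} {q : Input N → A} →
                         FiniteRange q → IndicatorsDeg≤ _≟_ d q →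
                         (h : A → B) → IndicatorsDeg≤ _≟ᴮ_ d (h ∘ q)
      IndicatorsDeg≤-∘ _≟ᴮ_ range q≤d h b = Deg≤-∘ range q≤d (λ a → 𝟙 (h a ≟ᴮ b))

      IndicatorsDeg≤-bit : ∀ i (h : Bool → A) → IndicatorsDeg≤ _≟_ 1 (λ x → h (x i))
      IndicatorsDeg≤-bit i h a = Deg≤-bit i (λ b → 𝟙 (h b ≟ a))

      Deg≤On-*-indicator : ∀ {C : Input N → Set} {d e G} {q : Input N → A} a →
                           IndicatorsDeg≤ _≟_ d q → Deg≤On (λ x → C x × q x ≡ a) e G →
                           Deg≤On C (d ℕ.+ e) (λ x → 𝟙 (q x ≟ a) * G x)
      Deg≤On-*-indicator {C} {G = G} {q} a q≤d (g , g≤e , g≡G) with q≤d a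
      ... | p , p≤d , p≡𝟙 = p *ₚ g , degree-*ₚ p≤d g≤e , λ x c →
        trans (eval-*ₚ p g x) (trans (cong (_* eval g x) (p≡𝟙 x _)) (on-level x c))
        where
        on-level : ∀ x → C x → 𝟙 (q x ≟ a) * eval g x ≡ 𝟙 (q x ≟ a) * G x
        on-level x c with q x ≟ a
        ... | yes qx≡a = cong (1ℚ *_) (g≡G x (c , qx≡a))
        ... | no  _    = trans (ℚ.*-zeroˡ (eval g x)) (sym (ℚ.*-zeroˡ (G x)))

  allInputs : ∀ N → List (Input N)
  allInputs zero    = Vector.[] ∷ []
  allInputs (suc N) = cartesianProductWith Vector._∷_ (true ∷ false ∷ []) (allInputs N)

  ∈-allInputs : ∀ {N} (x : Input N) → Σ (Input N) λ y → y ∈ allInputs N × y ≗ x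
  ∈-allInputs {zero}  x = Vector.[] , here refl , λ ()
  ∈-allInputs {suc N} x with ∈-allInputs (Vector.tail x)
  ... | y , y∈ , y≗ =
    Vector.head x Vector.∷ y , ∈.∈-cartesianProductWith⁺ Vector._∷_ (bit∈ (x zero)) y∈ , head∷y≗x
    where
    bit∈ : ∀ b → b ∈ true ∷ false ∷ []
    bit∈ true  = here refl
    bit∈ false = there (here refl)
    head∷y≗x : Vector.head x Vector.∷ y ≗ x
    head∷y≗x zero    = refl
    head∷y≗x (suc i) = y≗ i

  initStore-cong : ∀ {N} {x y : Input N} → x ≗ y → initStore x ≡ initStore y
  initStore-cong x≗y = List.map-cong (λ i → cong (λ b → inputKey i , bitℕ b) (x≗y i)) (allFin _)

  -- Without function extensionality a function on Input N need not visibly take finitely many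
  -- values; initStore does, since it only depends on the input pointwise.
  FiniteRange-initStore : ∀ {N} → FiniteRange (initStore {N})
  FiniteRange-initStore {N} = map initStore (allInputs N) , initStore∈
    where
    initStore∈ : ∀ x → initStore x ∈ map initStore (allInputs N)
    initStore∈ x with ∈-allInputs x
    ... | y , y∈ , y≗x =
      subst (_∈ map initStore (allInputs N)) (initStore-cong y≗x) (∈.∈-map⁺ initStore y∈)

  module _ {A : Set} (_≟_ : DecidableEquality A) where

    dropPrefix : List A → List A → Maybe (List A)
    dropPrefix []      W       = just W
    dropPrefix (l ∷ L) []      = nothing
    dropPrefix (l ∷ L) (w ∷ W) with l ≟ w
    ... | yes _ = dropPrefix L W
    ... | no  _ = nothing

    dropPrefix-++ : ∀ L Z → dropPrefix L (L ++ Z) ≡ just Z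
    dropPrefix-++ []      Z = refl
    dropPrefix-++ (l ∷ L) Z with l ≟ l
    ... | yes _   = dropPrefix-++ L Z
    ... | no  l≢l = ⊥-elim (l≢l refl)

    dropPrefix-just : ∀ L {W W′} → dropPrefix L W ≡ just W′ → L ++ W′ ≡ W
    dropPrefix-just []      refl = refl
    dropPrefix-just (l ∷ L) {w ∷ W} eq with l ≟ w
    ... | yes refl = cong (l ∷_) (dropPrefix-just L eq)

    𝟙-++ : ∀ L Z W →
           𝟙 (List.≡-dec _≟_ (L ++ Z) W)
             ≡ maybe′ (λ W′ → 𝟙 (List.≡-dec _≟_ Z W′)) 0ℚ (dropPrefix L W)
    𝟙-++ L Z W with dropPrefix L W in eq
    ... | just W′ = 𝟙-⇔ (mk⇔ (λ e → List.++-cancelˡ L _ _ (trans e (sym (dropPrefix-just L eq))))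
                             (λ e → trans (cong (L ++_) e) (dropPrefix-just L eq)))
                        (List.≡-dec _≟_ (L ++ Z) W) (List.≡-dec _≟_ Z W′)
    ... | nothing with List.≡-dec _≟_ (L ++ Z) W
    ...   | no  _        = refl
    ...   | yes refl with () ← trans (sym eq) (dropPrefix-++ L Z)

  length-++-≤ʳ : ∀ {A : Set} {n} (L : List A) {Z} → length (L ++ Z) ≤ n → length Z ≤ n
  length-++-≤ʳ L {Z} len≤ =
    ℕ.≤-trans (ℕ.m≤n+m (length Z) (length L)) (subst (_≤ _) (List.length-++ L) len≤)

  length-∷-++-≤ : ∀ {A : Set} {n} {l : A} L {Z} → length ((l ∷ L) ++ Z) ≤ suc n → length Z ≤ n
  length-∷-++-≤ L len≤ = length-++-≤ʳ L (ℕ.≤-pred len≤)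

  valuesAt-++ : ∀ k (D D′ : Store) → valuesAt k (D ++ D′) ≡ valuesAt k D ++ valuesAt k D′
  valuesAt-++ k D D′ =
    trans (cong (map proj₂) (List.filter-++ (λ kv → proj₁ kv ℕ.≟ k) D D′))
          (List.map-++ proj₂ (filter _ D) _)

  valuesAt-concat : ∀ {I : Set} k (D : I → Store) is →
                    valuesAt k (concat (map D is)) ≡ concat (map (λ i → valuesAt k (D i)) is)
  valuesAt-concat k D []       = refl
  valuesAt-concat k D (i ∷ is) =
    trans (valuesAt-++ k (D i) (concat (map D is))) (cong (valuesAt k (D i) ++_) (valuesAt-concat k D is))

  length-valuesAt≤1 : ∀ k (D : Store) → Unique (map proj₁ D) → length (valuesAt k D) ≤ 1
  length-valuesAt≤1 k []               _            = z≤n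
  length-valuesAt≤1 k ((k′ , v) ∷ D) (k′∉ ∷ unique) with k′ ℕ.≟ k
  ... | yes refl rewrite List.filter-accept (λ kv → proj₁ kv ℕ.≟ k) {(k , v)} {D} refl
                       | List.filter-none (λ kv → proj₁ kv ℕ.≟ k) (All.map (_∘ sym) (All.map⁻ k′∉))
                       = s≤s z≤n
  ... | no  k′≢k rewrite List.filter-reject (λ kv → proj₁ kv ℕ.≟ k) {(k′ , v)} {D} k′≢k
                       = length-valuesAt≤1 k D unique

  infix 4 _≟ᵥ_
  _≟ᵥ_ : DecidableEquality (List Value)
  _≟ᵥ_ = List.≡-dec ℕ._≟_

  Deg≤On-prefixed : ∀ {N C d} (Z : Input N → List Value) →
                    (∀ W′ → Deg≤On C d (λ x → 𝟙 (Z x ≟ᵥ W′))) →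
                    ∀ L W → Deg≤On C d (λ x → 𝟙 (L ++ Z x ≟ᵥ W))
  Deg≤On-prefixed {C = C} {d} Z Z≤d L W =
    Deg≤On-cong (λ x _ → sym (𝟙-++ ℕ._≟_ L (Z x) W)) (afterPrefix (dropPrefix ℕ._≟_ L W))
    where
    afterPrefix : ∀ m → Deg≤On C d (λ x → maybe′ (λ W′ → 𝟙 (Z x ≟ᵥ W′)) 0ℚ m)
    afterPrefix (just W′) = Z≤d W′
    afterPrefix nothing   = Deg≤On-const 0ℚ

  joined : ∀ {N} {I : Set} → (I → Input N → List Value) → List I → Input N → List Value
  joined q is x = concat (map (λ i → q i x) is)

  module _ {N : ℕ} {I : Set} {P : ℕ} (q : I → Input N → List Value)
           (q-range : ∀ i → FiniteRange (q i)) (q≤P : ∀ i → IndicatorsDeg≤ _≟ᵥ_ P (q i)) where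

    -- A nonempty first piece L trades [rest = W] with length budget t+1 for [rest = W minus L] with
    -- budget t; empty pieces cost nothing, so the degree does not depend on the number of pieces.
    Deg≤On-joined : ∀ is t W →
                    Deg≤On (λ x → length (joined q is x) ≤ t) (t ℕ.* P) (λ x → 𝟙 (joined q is x ≟ᵥ W))
    Deg≤On-joined []       t       W = Deg≤On-const (𝟙 ([] ≟ᵥ W))
    Deg≤On-joined (i ∷ is) zero    W = Deg≤On-cong empty (Deg≤On-const (𝟙 ([] ≟ᵥ W)))
      where
      empty : ∀ x → length (joined q (i ∷ is) x) ≤ 0 →
              𝟙 ([] ≟ᵥ W) ≡ 𝟙 (joined q (i ∷ is) x ≟ᵥ W)
      empty x len≤0 with joined q (i ∷ is) x
      empty x z≤n | [] = refl
    Deg≤On-joined (i ∷ is) (suc t) W =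
      Deg≤On-cong split
        (Deg≤On-+ (Deg≤On-weaken (λ x → length-++-≤ʳ (q i x)) (Deg≤On-joined is (suc t) W))
                  (Deg≤On-caseOn _≟ᵥ_ (q-range i) step step-term))
      where
      Z : Input N → List Value
      Z = joined q is

      step : List Value → Input N → ℚ
      step []      x = 0ℚ
      step (l ∷ L) x = 𝟙 ((l ∷ L) ++ Z x ≟ᵥ W) - 𝟙 (Z x ≟ᵥ W)

      split : ∀ x → length (q i x ++ Z x) ≤ suc t →
              𝟙 (Z x ≟ᵥ W) + step (q i x) x ≡ 𝟙 (q i x ++ Z x ≟ᵥ W)
      split x _ with q i x
      ... | []    = ℚ.+-identityʳ _
      ... | l ∷ L =
        solve 2 (λ a b → a :+ (b :- a) := b) refl (𝟙 (Z x ≟ᵥ W)) (𝟙 ((l ∷ L) ++ Z x ≟ᵥ W))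

      step-term : ∀ L → Deg≤On (λ x → length (q i x ++ Z x) ≤ suc t) (suc t ℕ.* P)
                               (λ x → 𝟙 (q i x ≟ᵥ L) * step L x)
      step-term []      = Deg≤On-cong (λ x _ → sym (ℚ.*-zeroʳ (𝟙 (q i x ≟ᵥ [])))) (Deg≤On-const 0ℚ)
      step-term (l ∷ L) = Deg≤On-*-indicator _≟ᵥ_ {q = q i} (l ∷ L) (q≤P i)
        (Deg≤On-weaken (λ x (len≤ , qx≡) →
                          length-∷-++-≤ {l = l} L (subst (λ L′ → length (L′ ++ Z x) ≤ suc t) qx≡ len≤))
                       (Deg≤On-- (Deg≤On-prefixed Z (Deg≤On-joined is t) (l ∷ L) W) (Deg≤On-joined is t W)))

    IndicatorsDeg≤-joined : ∀ is t → (∀ x → length (joined q is x) ≤ t) →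
                            IndicatorsDeg≤ _≟ᵥ_ (t ℕ.* P) (joined q is)
    IndicatorsDeg≤-joined is t len≤ W = Deg≤On-weaken (λ x _ → len≤ x) (Deg≤On-joined is t W)

  StoreDeg≤ : ∀ {N} → ℕ → (Input N → Store) → Set
  StoreDeg≤ d D = ∀ k → IndicatorsDeg≤ _≟ᵥ_ d (λ x → response k (D x))

  StoreDeg≤-mono : ∀ {N d e} {D : Input N → Store} → d ≤ e → StoreDeg≤ d D → StoreDeg≤ e D
  StoreDeg≤-mono d≤e D≤d k V = Deg≤On-mono d≤e (D≤d k V)

  module _ {N : ℕ} where

    StoreDeg≤-initStore : StoreDeg≤ 1 (initStore {N})
    StoreDeg≤-initStore k =
      IndicatorsDeg≤-∘ _≟ᵥ_ _≟ᵥ_ (FiniteRange-∘ (valuesAt k) FiniteRange-initStore) values≤1 sort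
      where
      entry : Fin N → Input N → Store
      entry i x = (inputKey i , bitℕ (x i)) ∷ []

      cell : Fin N → Bool → List Value
      cell i b = valuesAt k ((inputKey i , bitℕ b) ∷ [])

      piece : Fin N → Input N → List Value
      piece i x = cell i (x i)

      valuesAt-initStore : ∀ x → valuesAt k (initStore x) ≡ joined piece (allFin N) x
      valuesAt-initStore x = begin
        valuesAt k (initStore x)
          ≡⟨ cong (valuesAt k) (List.concat-map-[ initStore x ]) ⟨
        valuesAt k (concat (map [_] (initStore x)))
          ≡⟨ cong (valuesAt k ∘ concat) (List.map-∘ (allFin N)) ⟨
        valuesAt k (concat (map (λ i → entry i x) (allFin N)))
          ≡⟨ valuesAt-concat k (λ i → entry i x) (allFin N) ⟩
        joined piece (allFin N) x
          ∎
        where open ≡-Reasoning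

      one-entry : ∀ x → length (joined piece (allFin N) x) ≤ 1
      one-entry x =
        subst (λ V → length V ≤ 1) (valuesAt-initStore x) (length-valuesAt≤1 k (initStore x) keys-unique)
        where
        keys-unique : Unique (map proj₁ (initStore x))
        keys-unique = subst Unique (List.map-∘ (allFin N))
          (Unique.map⁺ (λ e → Fin.toℕ-injective (ℕ.suc-injective e)) (Unique.allFin⁺ N))

      values≤1 : IndicatorsDeg≤ _≟ᵥ_ 1 (λ x → valuesAt k (initStore x))
      values≤1 W = Deg≤On-cong (λ x _ → cong (λ V → 𝟙 (V ≟ᵥ W)) (sym (valuesAt-initStore x)))
        (IndicatorsDeg≤-joined piece (λ i → FiniteRange-bit i (cell i)) (λ i → IndicatorsDeg≤-bit _≟ᵥ_ i (cell i))
                               (allFin N) 1 one-entry W)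

  cost-positive : ∀ V → 1 ≤ cost V
  cost-positive []      = s≤s z≤n
  cost-positive (_ ∷ _) = s≤s z≤n

  afterResponse : ℕ → ℕ → Strategy → Store → History → Key → List Value → Maybe Store
  afterResponse f b σ D h k V with cost V ℕ.≤? b
  ... | yes _ = run f (b ∸ cost V) σ D ((k , V) ∷ h)
  ... | no  _ = nothing

  run-stop : ∀ f b σ D h {w} → σ h ≡ inj₂ w → run (suc f) b σ D h ≡ just w
  run-stop f b σ D h σh≡ rewrite σh≡ = refl

  run-query : ∀ f b σ D h {k} → σ h ≡ inj₁ k →
              run (suc f) b σ D h ≡ afterResponse f b σ D h k (response k D)
  run-query f b σ D h {k} σh≡ rewrite σh≡ with cost (response k D) ℕ.≤? b
  ... | yes _ = refl
  ... | no  _ = refl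

  afterResponse-within : ∀ f b σ D h k V → cost V ≤ b →
                         afterResponse f b σ D h k V ≡ run f (b ∸ cost V) σ D ((k , V) ∷ h)
  afterResponse-within f b σ D h k V cost≤b with cost V ℕ.≤? b
  ... | yes _      = refl
  ... | no  cost≰b = ⊥-elim (cost≰b cost≤b)

  afterResponse-beyond : ∀ f b σ D h k V → ¬ cost V ≤ b → afterResponse f b σ D h k V ≡ nothing
  afterResponse-beyond f b σ D h k V cost≰b with cost V ℕ.≤? b
  ... | yes cost≤b = ⊥-elim (cost≰b cost≤b)
  ... | no  _      = refl

  m+[n∸o]*m≤n*m : ∀ m n o → 1 ≤ o → o ≤ n → m ℕ.+ (n ∸ o) ℕ.* m ≤ n ℕ.* m
  m+[n∸o]*m≤n*m m (suc n) (suc o) _ _ = ℕ.+-monoʳ-≤ m (ℕ.*-monoˡ-≤ m (ℕ.m∸n≤m n o))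

  infix 4 _≟ₘ_
  _≟ₘ_ : DecidableEquality (Maybe Store)
  _≟ₘ_ = Maybe.≡-dec (List.≡-dec (Product.≡-dec ℕ._≟_ ℕ._≟_))

  module _ {N d} {D : Input N → Store} (D-range : FiniteRange D) (D≤d : StoreDeg≤ d D) (σ : Strategy) where

    -- Shifting by the constant [nothing = o] makes the terms of unaffordable responses vanish;
    -- an affordable response costs at least 1, which pays for the degree d of its indicator.
    IndicatorsDeg≤-afterResponse :
      ∀ f b h k → (∀ b′ h′ → IndicatorsDeg≤ _≟ₘ_ (b′ ℕ.* d) (λ x → run f b′ σ (D x) h′)) →
      IndicatorsDeg≤ _≟ₘ_ (b ℕ.* d) (λ x → afterResponse f b σ (D x) h k (response k (D x)))
    IndicatorsDeg≤-afterResponse f b h k run≤ o =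
      Deg≤On-cong (λ x _ → solve 2 (λ c r → c :+ (r :- c) := r) refl failed (outcome (response k (D x)) x))
        (Deg≤On-+ (Deg≤On-const failed)
                  (Deg≤On-caseOn _≟ᵥ_ (FiniteRange-∘ (response k) D-range) shifted term))
      where
      failed : ℚ
      failed = 𝟙 (nothing ≟ₘ o)

      outcome : List Value → Input N → ℚ
      outcome V x = 𝟙 (afterResponse f b σ (D x) h k V ≟ₘ o)

      shifted : List Value → Input N → ℚ
      shifted V x = outcome V x - failed

      term : ∀ V → Deg≤ (b ℕ.* d) (λ x → 𝟙 (response k (D x) ≟ᵥ V) * shifted V x)
      term V = byBudget (cost V ℕ.≤? b)
        where
        byBudget : Dec (cost V ≤ b) → Deg≤ (b ℕ.* d) (λ x → 𝟙 (response k (D x) ≟ᵥ V) * shifted V x)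
        byBudget (yes cost≤b) = Deg≤On-mono (m+[n∸o]*m≤n*m d b (cost V) (cost-positive V) cost≤b)
          (Deg≤On-* (D≤d k V)
            (Deg≤On-cong (λ x _ → cong (λ m → 𝟙 (m ≟ₘ o) - failed)
                                       (sym (afterResponse-within f b σ (D x) h k V cost≤b)))
                         (Deg≤On-- (run≤ (b ∸ cost V) ((k , V) ∷ h) o) (Deg≤On-const failed))))
        byBudget (no cost≰b) = Deg≤On-cong vanish (Deg≤On-const 0ℚ)
          where
          vanish : ∀ x → ⊤ → 0ℚ ≡ 𝟙 (response k (D x) ≟ᵥ V) * shifted V x
          vanish x _ = begin
            0ℚ                           ≡⟨ solve 2 (λ a c → con 0ℚ := a :* (c :- c)) refl isV failed ⟩
            isV * (failed - failed)      ≡⟨ cong (λ m → isV * (𝟙 (m ≟ₘ o) - failed)) after≡ ⟨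
            isV * shifted V x            ∎
            where
            open ≡-Reasoning
            isV : ℚ
            isV = 𝟙 (response k (D x) ≟ᵥ V)
            after≡ : afterResponse f b σ (D x) h k V ≡ nothing
            after≡ = afterResponse-beyond f b σ (D x) h k V cost≰b

    IndicatorsDeg≤-run : ∀ f b h → IndicatorsDeg≤ _≟ₘ_ (b ℕ.* d) (λ x → run f b σ (D x) h)
    IndicatorsDeg≤-run zero    b h o = Deg≤On-const (𝟙 (nothing ≟ₘ o))
    IndicatorsDeg≤-run (suc f) b h o = nextMove (σ h) refl
      where
      nextMove : ∀ move → σ h ≡ move → Deg≤ (b ℕ.* d) (λ x → 𝟙 (run (suc f) b σ (D x) h ≟ₘ o))
      nextMove (inj₂ w) σh≡ =
        Deg≤On-cong (λ x _ → cong (λ m → 𝟙 (m ≟ₘ o)) (sym (run-stop f b σ (D x) h σh≡)))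
                    (Deg≤On-const (𝟙 (just w ≟ₘ o)))
      nextMove (inj₁ k) σh≡ =
        Deg≤On-cong (λ x _ → cong (λ m → 𝟙 (m ≟ₘ o)) (sym (run-query f b σ (D x) h σh≡)))
                    (IndicatorsDeg≤-afterResponse f b h k (IndicatorsDeg≤-run f) o)

  StoreDeg≤-roundOut : ∀ {N S d} (ρ : Round) {D : Input N → Store} → FiniteRange D → StoreDeg≤ d D →
                       (∀ x → KeyOK S ρ (D x)) →
                       StoreDeg≤ (S ℕ.* (S ℕ.* d)) (λ x → roundOut S ρ (D x))
  StoreDeg≤-roundOut {N} {S} {d} ρ {D} D-range D≤d keyOK k =
    IndicatorsDeg≤-∘ _≟ᵥ_ _≟ᵥ_ (FiniteRange-∘ (λ s → valuesAt k (roundOut S ρ s)) D-range) values≤ sort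
    where
    written : Fin (M ρ) → Store → Maybe Store
    written i s = runMachine S (machine ρ i) s

    piece : Fin (M ρ) → Input N → List Value
    piece i x = valuesAt k (fromMaybe [] (written i (D x)))

    piece≤ : ∀ i → IndicatorsDeg≤ _≟ᵥ_ (S ℕ.* d) (piece i)
    piece≤ i = IndicatorsDeg≤-∘ _≟ₘ_ _≟ᵥ_ (FiniteRange-∘ (written i) D-range)
                 (IndicatorsDeg≤-run D-range D≤d (machine ρ i) (suc S) S []) (valuesAt k ∘ fromMaybe [])

    valuesAt-roundOut : ∀ x → valuesAt k (roundOut S ρ (D x)) ≡ joined piece (allFin (M ρ)) x
    valuesAt-roundOut x = valuesAt-concat k (λ i → fromMaybe [] (written i (D x))) (allFin (M ρ))

    values≤ : IndicatorsDeg≤ _≟ᵥ_ (S ℕ.* (S ℕ.* d)) (λ x → valuesAt k (roundOut S ρ (D x)))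
    values≤ W = Deg≤On-cong (λ x _ → cong (λ V → 𝟙 (V ≟ᵥ W)) (sym (valuesAt-roundOut x)))
      (IndicatorsDeg≤-joined piece (λ i → FiniteRange-∘ (λ s → valuesAt k (fromMaybe [] (written i s))) D-range)
                             piece≤ (allFin (M ρ)) S
                             (λ x → subst (λ V → length V ≤ S) (valuesAt-roundOut x) (keyOK x k)) W)

  ^-double-suc : ∀ m n o → m ^ (2 ℕ.* n) ℕ.* (m ℕ.* (m ℕ.* o)) ≡ m ^ (2 ℕ.* suc n) ℕ.* o
  ^-double-suc m n o = trans
    (ℕS.solve 3 (λ p m o → p ℕS.:* (m ℕS.:* (m ℕS.:* o)) ℕS.:= m ℕS.:* (m ℕS.:* p) ℕS.:* o)
                refl (m ^ (2 ℕ.* n)) m o)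
    (cong (λ e → m ^ e ℕ.* o) (sym (ℕ.*-suc 2 n)))

  StoreDeg≤-finalStore : ∀ {N S R d} (A : Algorithm R) {D : Input N → Store} →
                         FiniteRange D → StoreDeg≤ d D → (∀ x → AllRounds S (KeyOK S) A (D x)) →
                         StoreDeg≤ (S ^ (2 ℕ.* R) ℕ.* d) (λ x → finalStore S A (D x))
  StoreDeg≤-finalStore {d = d} Vec.[] {D} D-range D≤d _ =
    StoreDeg≤-mono {D = D} (ℕ.≤-reflexive (sym (ℕ.*-identityˡ d))) D≤d
  StoreDeg≤-finalStore {S = S} {suc R} {d} (ρ Vec.∷ A) {D} D-range D≤d keyOK =
    StoreDeg≤-mono {D = λ x → finalStore S A (roundOut S ρ (D x))} (ℕ.≤-reflexive (^-double-suc S R d))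
      (StoreDeg≤-finalStore A {λ x → roundOut S ρ (D x)} (FiniteRange-∘ (roundOut S ρ) D-range)
        (StoreDeg≤-roundOut ρ D-range D≤d (proj₁ ∘ keyOK)) (proj₂ ∘ keyOK))

  module _ {N S R} {Δ : Input N → Set} {g : ∀ x → Δ x → Bool} {A : Algorithm R}
           (computes : Computes S R Δ g A) where

    answerIsOne : Input N → ℚ
    answerIsOne x = 𝟙 (response answerKey (finalStore S A (initStore x)) ≟ᵥ 1 ∷ [])

    answerIsOne-correct : ∀ x (d : Δ x) → answerIsOne x ≡ bitℚ (g x d)
    answerIsOne-correct x d = single-answer _ (g x d) (Computes.correct computes x d)
      where
      single-answer : ∀ vs b → vs ≡ bitℕ b ∷ [] → 𝟙 (sort vs ≟ᵥ 1 ∷ []) ≡ bitℚ b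
      single-answer _ true  refl = refl
      single-answer _ false refl = refl

    answerPolynomial : Σ (Poly N) λ p → DegreeAtMost (S ^ (2 ℕ.* R)) p
                         × (∀ x (d : Δ x) → eval p x ≡ bitℚ (g x d))
                         × (∀ x → eval p x ≡ 0ℚ ⊎ eval p x ≡ 1ℚ)
    answerPolynomial =
      let p , p≤ , p≡ = Deg≤On-mono (ℕ.≤-reflexive (ℕ.*-identityʳ _))
                          (StoreDeg≤-finalStore A FiniteRange-initStore StoreDeg≤-initStore
                                                (Computes.perKey computes) answerKey (1 ∷ []))
      in p , p≤
           , (λ x d → trans (p≡ x _) (answerIsOne-correct x d))
           , λ x → Sum.map (trans (p≡ x _)) (trans (p≡ x _))
                           (𝟙-boolean (response answerKey (finalStore S A (initStore x)) ≟ᵥ 1 ∷ []))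

  module _ {N : ℕ} where

    bitℚ-idem : ∀ b → bitℚ b * bitℚ b ≡ bitℚ b
    bitℚ-idem true  = refl
    bitℚ-idem false = refl

    without : Fin N → Monomial N → Monomial N
    without i = filter (λ j → ¬? (i Fin.≟ j))

    evalMon-without : ∀ (x : Input N) i m → bitℚ (x i) * evalMon x (without i m) ≡ bitℚ (x i) * evalMon x m
    evalMon-without x i []      = refl
    evalMon-without x i (j ∷ m) with i Fin.≟ j
    ... | yes refl = begin
      bitℚ (x i) * evalMon x (without i m)        ≡⟨ evalMon-without x i m ⟩
      bitℚ (x i) * evalMon x m                    ≡⟨ cong (_* evalMon x m) (bitℚ-idem (x i)) ⟨
      bitℚ (x i) * bitℚ (x i) * evalMon x m       ≡⟨ ℚ.*-assoc (bitℚ (x i)) _ _ ⟩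
      bitℚ (x i) * (bitℚ (x i) * evalMon x m)     ∎
      where open ≡-Reasoning
    ... | no  _    = begin
      bitℚ (x i) * (bitℚ (x j) * evalMon x (without i m))  ≡⟨ swap (bitℚ (x i)) (bitℚ (x j)) _ ⟩
      bitℚ (x j) * (bitℚ (x i) * evalMon x (without i m))  ≡⟨ cong (bitℚ (x j) *_) (evalMon-without x i m) ⟩
      bitℚ (x j) * (bitℚ (x i) * evalMon x m)              ≡⟨ swap (bitℚ (x j)) (bitℚ (x i)) _ ⟩
      bitℚ (x i) * (bitℚ (x j) * evalMon x m)              ∎
      where
      open ≡-Reasoning
      swap : ∀ a b c → a * (b * c) ≡ b * (a * c)
      swap = solve 3 (λ a b c → a :* (b :* c) := b :* (a :* c)) refl

    evalMon-deduplicate : ∀ (x : Input N) m → evalMon x (deduplicate Fin._≟_ m) ≡ evalMon x m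
    evalMon-deduplicate x []      = refl
    evalMon-deduplicate x (i ∷ m) =
      trans (evalMon-without x i (deduplicate Fin._≟_ m)) (cong (bitℚ (x i) *_) (evalMon-deduplicate x m))

    multilinearize : Poly N → Poly N
    multilinearize = map (λ (c , m) → c , deduplicate Fin._≟_ m)

    eval-multilinearize : ∀ p x → eval (multilinearize p) x ≡ eval p x
    eval-multilinearize []            x = refl
    eval-multilinearize ((c , m) ∷ p) x =
      cong₂ _+_ (cong (c *_) (evalMon-deduplicate x m)) (eval-multilinearize p x)

    multilinearize-multilinear : ∀ p → Multilinear (multilinearize p)
    multilinearize-multilinear []      = []
    multilinearize-multilinear (_ ∷ p) = deduplicate-! Fin._≟_ _ ∷ multilinearize-multilinear p

    multilinearize-degree : ∀ {d} {p : Poly N} → DegreeAtMost d p → DegreeAtMost d (multilinearize p)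
    multilinearize-degree {p = []}          []          = []
    multilinearize-degree {p = (_ , m) ∷ _} (m≤d ∷ p≤d) =
      ℕ.≤-trans (List.length-deduplicate Fin._≟_ m) m≤d ∷ multilinearize-degree p≤d

open import Defs
open import Data.Nat using (ℕ; _^_; _*_)
open import Data.Bool using (Bool)
open import Data.Product using (Σ; _×_; _,_)
open import Data.Sum using (_⊎_)
open import Data.Unit using (⊤; tt)
open import Data.Rational using (0ℚ; 1ℚ)
open import Relation.Nullary using (¬_)
open import Relation.Binary.PropositionalEquality using (_≡_; trans)
open PolynomialSimulation

theorem3p2 :
    (∀ (N S R : ℕ) (Δ : Input N → Set) (g : ∀ x → Δ x → Bool) (A : Algorithm R) →
       Computes S R Δ g A →
       Σ (Poly N) λ p → DegreeAtMost (S ^ (2 * R)) p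
         × (∀ x (d : Δ x) → eval p x ≡ bitℚ (g x d))
         × (∀ x → ¬ Δ x → (eval p x ≡ 0ℚ) ⊎ (eval p x ≡ 1ℚ)))
    × (∀ (N S R : ℕ) (g : Input N → Bool) (A : Algorithm R) →
       Computes S R (λ _ → ⊤) (λ x _ → g x) A →
       DegAtMost g (S ^ (2 * R)))
theorem3p2 =
  (λ N S R Δ g A computes →
     let p , p≤ , p≡g , boolean = answerPolynomial computes
     in p , p≤ , p≡g , λ x _ → boolean x)
  , λ N S R g A computes →
      let p , p≤ , p≡g , _ = answerPolynomial computes
      in multilinearize p , multilinearize-multilinear p , multilinearize-degree p≤
         , λ x → trans (eval-multilinearize p x) (p≡g x tt)
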